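{- For every $k\ge 1$, the Harmonic Algorithm for the generalized $k$-server problem on uniform metrics is $(k\cdot\alpha_k)$-competitive (against an adaptive online adversary), where $\alpha_1=1$ and $\alpha_\ell = 1+(\ell-1)\alpha_{\ell-1}$ for $\ell>1$.
   Context: Generalized $k$-server problem on uniform metrics: there are $k$ uniform metric spaces $M_1,\dots,M_k$, each with point set $[n]$ and all pairwise distances equal to $1$. A configuration is $q=(q_1,\dots,q_k)\in[n]^k$ (server $s_i$ is at point $q_i$ of $M_i$). A request is $r=(r_1,\dots,r_k)\in[n]^k$; it is served by a configuration $q$ if $q_i=r_i$ for some $i$, and otherwise some server must be moved so that this holds. Moving server $s_i$ to a different point costs $1$, so the cost of changing configuration from $q$ to $q'$ is the Hamming distance $d_H(q,q')=|\{i: q_i\neq q'_i\}|$. A randomized memoryless algorithm is given by a probability distribution $(p_1,\dots,p_k)$: on request $r$, if its current configuration serves $r$ it does nothing; otherwise it picks $i$ with probability $p_i$ and moves server $s_i$ to $r_i$. The Harmonic Algorithm is the memoryless algorithm with $p_i=1/k$ for all $i$. Competitiveness is measured against an adaptive online adversary that starts from the same initial configuration: an algorithm is $c$-competitive if for every (adaptive) request sequence its expected total cost is at most $c$ times the adversary's total cost (up to an additive constant). -}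

module Defs where

open import Data.Nat using (ℕ; zero; suc; NonZero)
import Data.Nat as N
open import Data.Integer using (+_)
open import Data.Rational using (ℚ; _/_; 0ℚ; 1ℚ; _+_; _*_)
open import Data.Fin using (Fin; zero; suc; _≟_)
open import Data.Fin.Properties using (any?)
open import Data.Product using (Σ; ∃; _×_; _,_)
open import Data.Unit using (⊤)
open import Relation.Nullary using (yes; no)
open import Relation.Binary.PropositionalEquality using (_≡_)

-- A configuration (or a request): point q i ∈ [n] for each of the k metric spaces.
Config : ℕ → ℕ → Set
Config k n = Fin k → Fin n

Serves : ∀ {k n} → Config k n → Config k n → Set
Serves {k} q r = ∃ λ (i : Fin k) → q i ≡ r i

hamming : ∀ {k n} → Config k n → Config k n → ℕ
hamming {zero}  q q' = 0
hamming {suc k} q q' with q zero ≟ q' zero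
... | yes _ = hamming (λ i → q (suc i)) (λ i → q' (suc i))
... | no  _ = suc (hamming (λ i → q (suc i)) (λ i → q' (suc i)))

update : ∀ {k n} → Config k n → Fin k → Fin n → Config k n
update q i x j with j ≟ i
... | yes _ = x
... | no  _ = q j

toℚ : ℕ → ℚ
toℚ m = + m / 1

sumFin : ∀ {k} → (Fin k → ℚ) → ℚ
sumFin {zero}  f = 0ℚ
sumFin {suc k} f = f zero + sumFin (λ i → f (suc i))

-- Adaptive online adversary for T remaining steps: it chooses the next request r
-- together with its own new configuration a' (which must serve r), and then
-- continues depending on the algorithm's new configuration (hence on the whole
-- history, since this is a tree).
Adv : ℕ → ℕ → ℕ → Set
Adv k n zero    = ⊤
Adv k n (suc T) = Σ (Config k n) λ r → Σ (Config k n) λ a' →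
                    Serves a' r × (Config k n → Adv k n T)

module Harmonic (k n : ℕ) .{{_ : NonZero k}} where

  -- Expectation of f over the Harmonic Algorithm's next configuration,
  -- from configuration q on request r.
  expect : Config k n → Config k n → (Config k n → ℚ) → ℚ
  expect q r f with any? (λ i → q i ≟ r i)
  ... | yes _ = f q
  ... | no  _ = (+ 1 / k) * sumFin (λ i → f (update q i (r i)))

  -- Cost paid by the algorithm in this step (it moves exactly one server iff not served).
  stepCost : Config k n → Config k n → ℚ
  stepCost q r with any? (λ i → q i ≟ r i)
  ... | yes _ = 0ℚ
  ... | no  _ = 1ℚ

  -- Expected total cost of the Harmonic Algorithm (alg. config q, adv. config a).
  algCost : (T : ℕ) → Adv k n T → Config k n → Config k n → ℚ
  algCost zero    _                  q a = 0ℚ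
  algCost (suc T) (r , a' , _ , nxt) q a =
    stepCost q r + expect q r (λ q' → algCost T (nxt q') q' a')

  advCost : (T : ℕ) → Adv k n T → Config k n → Config k n → ℚ
  advCost zero    _                  q a = 0ℚ
  advCost (suc T) (r , a' , _ , nxt) q a =
    toℚ (hamming a a') + expect q r (λ q' → advCost T (nxt q') q' a')

-- alpha l = α_l for l ≥ 1 (α_1 = 1, α_l = 1 + (l-1) α_{l-1}); alpha 0 = 0 is a dummy.
alpha : ℕ → ℕ
alpha zero    = 0
alpha (suc l) = suc (l N.* alpha l)

module Submission where

-- Amortised analysis. Let m be the number of coordinates on which the algorithm and the
-- adversary agree and Σα m = α_1 + … + α_m; the potential is Φ = k·(Σα k − Σα m).
-- An adversary move of cost d changes m by at most d, so Φ grows by at most k·α_k·d.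
-- On an unserved request the algorithm pays 1; moving server i lowers m by one for each
-- of the m coordinates where it agreed with the adversary, and raises it by one where the
-- adversary serves the request (at least one i), and never changes it otherwise. Hence
-- k·E[Σα m'] ≥ k·Σα m − m·α_m + α_(m+1) = k·Σα m + 1: the expected drop of Φ pays the move.

open import Defs
open import Data.Nat using (ℕ; NonZero; zero; suc; z≤n; s≤s; _≤′_; ≤′-refl; ≤′-step)
import Data.Nat as N
import Data.Nat.Properties as ℕ
import Data.Nat.Solver as ℕ-Solver
open import Data.Nat.Coprimality using (1-coprimeTo) renaming (sym to coprime-sym)
import Data.Integer as ℤ
import Data.Integer.Properties as ℤ
open import Data.Rational using (ℚ; _≤_; _+_; _*_; mkℚ; 0ℚ; 1ℚ; _/_; *≤*; toℚᵘ; NonNegative)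
open import Data.Rational.Properties
  using (normalize-coprime; normalize-nonNeg; toℚᵘ-injective; toℚᵘ-homo-+; *-inverseˡ;
         +-identityˡ; +-identityʳ; +-assoc; +-comm; *-zeroˡ; *-zeroʳ; *-identityˡ; *-assoc;
         *-distribˡ-+; *-distribʳ-+; ≤-refl; ≤-trans; ≤-reflexive; +-mono-≤; +-monoˡ-≤; +-monoʳ-≤;
         *-monoˡ-≤-nonNeg; nonNegative⁻¹; module ≤-Reasoning)
import Data.Rational.Solver as ℚ-Solver
open import Data.Rational.Unnormalised as ℚᵘ using (mkℚᵘ)
import Data.Rational.Unnormalised.Properties as ℚᵘ
open import Algebra.Properties.Semiring.Sum ℕ.+-*-semiring
  using (sum; sum-syntax; sum-cong-≗; ∑-distrib-+; *-distribˡ-sum; *-distribʳ-sum)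
open import Data.Fin using (Fin; zero; suc) renaming (_≟_ to _≟ᶠ_)
open import Data.Fin.Properties using (any?; suc-injective)
open import Data.Product using (∃; _,_)
open import Data.Empty using (⊥-elim)
open import Function using (_∘_)
open import Relation.Nullary using (yes; no)
open import Relation.Binary.PropositionalEquality
  using (_≡_; _≢_; refl; sym; trans; cong; cong₂; subst; subst₂; module ≡-Reasoning)

mono-from-step : ∀ {f : ℕ → ℕ} → (∀ l → f l N.≤ f (suc l)) → ∀ {l l'} → l N.≤ l' → f l N.≤ f l'
mono-from-step {f} step h = go (ℕ.≤⇒≤′ h)
  where
  go : ∀ {l l'} → l ≤′ l' → f l N.≤ f l'
  go ≤′-refl      = ℕ.≤-refl
  go (≤′-step h) = ℕ.≤-trans (go h) (step _)

∑-const : ∀ {k} c → ∑[ i < k ] c ≡ k N.* c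
∑-const {zero}  c = refl
∑-const {suc k} c = cong (c N.+_) (∑-const {k} c)

∑-mono-≤ : ∀ {k} {f g : Fin k → ℕ} → (∀ i → f i N.≤ g i) → sum f N.≤ sum g
∑-mono-≤ {zero}  h = z≤n
∑-mono-≤ {suc k} h = ℕ.+-mono-≤ (h zero) (∑-mono-≤ (λ i → h (suc i)))

term≤∑ : ∀ {k} (f : Fin k → ℕ) j → f j N.≤ sum f
term≤∑ f zero    = ℕ.m≤m+n (f zero) _
term≤∑ f (suc j) = ℕ.≤-trans (term≤∑ (λ i → f (suc i)) j) (ℕ.m≤n+m _ (f zero))

∑-exchange : ∀ {k} {f g : Fin k → ℕ} i → (∀ j → j ≢ i → f j ≡ g j) →
             sum f N.+ g i ≡ sum g N.+ f i
∑-exchange {suc k} {f} {g} zero h = begin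
  f zero N.+ sum (λ j → f (suc j)) N.+ g zero ≡⟨ cong (λ s → f zero N.+ s N.+ g zero) (sum-cong-≗ (λ j → h (suc j) λ ())) ⟩
  f zero N.+ sum (λ j → g (suc j)) N.+ g zero ≡⟨ solve 3 (λ a s b → (a :+ s) :+ b := (b :+ s) :+ a) refl (f zero) _ (g zero) ⟩
  g zero N.+ sum (λ j → g (suc j)) N.+ f zero ∎
  where open ≡-Reasoning; open ℕ-Solver.+-*-Solver
∑-exchange {suc k} {f} {g} (suc i) h = begin
  f zero N.+ sum (λ j → f (suc j)) N.+ g (suc i)   ≡⟨ ℕ.+-assoc (f zero) _ _ ⟩
  f zero N.+ (sum (λ j → f (suc j)) N.+ g (suc i)) ≡⟨ cong₂ N._+_ (h zero λ ()) (∑-exchange i λ j j≢i → h (suc j) (j≢i ∘ suc-injective)) ⟩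
  g zero N.+ (sum (λ j → g (suc j)) N.+ f (suc i)) ≡⟨ ℕ.+-assoc (g zero) _ _ ⟨
  g zero N.+ sum (λ j → g (suc j)) N.+ f (suc i)   ∎
  where open ≡-Reasoning

same : ∀ {n} → Fin n → Fin n → ℕ
same x y with x ≟ᶠ y
... | yes _ = 1
... | no  _ = 0

differ : ∀ {n} → Fin n → Fin n → ℕ
differ x y with x ≟ᶠ y
... | yes _ = 0
... | no  _ = 1

same≤1 : ∀ {n} (x y : Fin n) → same x y N.≤ 1
same≤1 x y with x ≟ᶠ y
... | yes _ = ℕ.≤-refl
... | no  _ = z≤n

same-refl : ∀ {n} (x : Fin n) → same x x ≡ 1
same-refl x with x ≟ᶠ x
... | yes _   = refl
... | no  x≢x = ⊥-elim (x≢x refl)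

same+same≤1 : ∀ {n} {x y : Fin n} z → x ≢ y → same x z N.+ same y z N.≤ 1
same+same≤1 {x = x} {y} z x≢y with x ≟ᶠ z | y ≟ᶠ z
... | yes x≡z | yes y≡z = ⊥-elim (x≢y (trans x≡z (sym y≡z)))
... | yes _   | no  _   = ℕ.≤-refl
... | no  _   | yes _   = ℕ.≤-refl
... | no  _   | no  _   = z≤n

same-triangle : ∀ {n} (x y z : Fin n) → same x y N.≤ same x z N.+ differ y z
same-triangle x y z with y ≟ᶠ z
... | yes refl = ℕ.m≤m+n _ 0
... | no  _    = ℕ.≤-trans (same≤1 x y) (ℕ.m≤n+m 1 _)

hamming≡∑differ : ∀ {k n} (q q' : Config k n) → hamming q q' ≡ ∑[ i < k ] differ (q i) (q' i)
hamming≡∑differ {zero}  q q' = refl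
hamming≡∑differ {suc k} q q' with q zero ≟ᶠ q' zero
... | yes _ = hamming≡∑differ (q ∘ suc) (q' ∘ suc)
... | no  _ = cong suc (hamming≡∑differ (q ∘ suc) (q' ∘ suc))

agree : ∀ {k n} → Config k n → Config k n → ℕ
agree {k} q a = ∑[ i < k ] same (q i) (a i)

agree≤k : ∀ {k n} (q a : Config k n) → agree q a N.≤ k
agree≤k {k} q a = ℕ.≤-trans (∑-mono-≤ (λ i → same≤1 (q i) (a i))) (ℕ.≤-reflexive (trans (∑-const {k} 1) (ℕ.*-identityʳ k)))

agree≤agree+hamming : ∀ {k n} (q a a' : Config k n) → agree q a N.≤ agree q a' N.+ hamming a a'
agree≤agree+hamming {k} q a a' = begin
  agree q a                                                   ≤⟨ ∑-mono-≤ (λ i → same-triangle (q i) (a i) (a' i)) ⟩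
  ∑[ i < k ] (same (q i) (a' i) N.+ differ (a i) (a' i))      ≡⟨ ∑-distrib-+ (λ i → same (q i) (a' i)) (λ i → differ (a i) (a' i)) ⟩
  agree q a' N.+ ∑[ i < k ] differ (a i) (a' i)               ≡⟨ cong (agree q a' N.+_) (hamming≡∑differ a a') ⟨
  agree q a' N.+ hamming a a'                                 ∎
  where open ℕ.≤-Reasoning

agree-update : ∀ {k n} (q a : Config k n) i x →
               agree (update q i x) a N.+ same (q i) (a i) ≡ agree q a N.+ same x (a i)
agree-update q a i x = trans
  (∑-exchange {f = λ j → same (update q i x j) (a j)} {g = λ j → same (q j) (a j)} i
    (λ j j≢i → cong (λ y → same y (a j)) (update-≢ j≢i)))
  (cong (λ y → agree q a N.+ same y (a i)) update-≡)
  where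
  update-≡ : update q i x i ≡ x
  update-≡ with i ≟ᶠ i
  ... | yes _   = refl
  ... | no  i≢i = ⊥-elim (i≢i refl)
  update-≢ : ∀ {j} → j ≢ i → update q i x j ≡ q j
  update-≢ {j} j≢i with j ≟ᶠ i
  ... | yes j≡i = ⊥-elim (j≢i j≡i)
  ... | no  _   = refl

serves⇒agree>0 : ∀ {k n} {a r : Config k n} → Serves a r → 0 N.< agree r a
serves⇒agree>0 {a = a} {r} (j , aj≡rj) =
  subst (N._≤ agree r a) (trans (cong (same (r j)) aj≡rj) (same-refl (r j)))
    (term≤∑ (λ i → same (r i) (a i)) j)

Σα : ℕ → ℕ
Σα zero    = 0
Σα (suc m) = Σα m N.+ alpha (suc m)

alpha-mono : ∀ {l l'} → l N.≤ l' → alpha l N.≤ alpha l'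
alpha-mono = mono-from-step step
  where
  step : ∀ l → alpha l N.≤ alpha (suc l)
  step zero    = z≤n
  step (suc l) = ℕ.m≤n⇒m≤1+n (ℕ.m≤m+n (alpha (suc l)) (l N.* alpha (suc l)))

Σα-mono : ∀ {m m'} → m N.≤ m' → Σα m N.≤ Σα m'
Σα-mono = mono-from-step (λ m → ℕ.m≤m+n (Σα m) _)

Σα-lipschitz : ∀ {K m'} d {m} → m N.≤ m' N.+ d → m N.≤ K → Σα m N.≤ Σα m' N.+ d N.* alpha K
Σα-lipschitz {K} {m'} zero {m} m≤m' _ = ℕ.≤-trans (Σα-mono (subst (m N.≤_) (ℕ.+-identityʳ m') m≤m')) (ℕ.m≤m+n _ 0)
Σα-lipschitz          (suc d) {zero} _ _ = z≤n
Σα-lipschitz {K} {m'} (suc d) {suc m} m<m'+d m<K = begin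
  Σα m N.+ alpha (suc m)                     ≤⟨ ℕ.+-mono-≤ (Σα-lipschitz d m≤m'+d (ℕ.<⇒≤ m<K)) (alpha-mono m<K) ⟩
  Σα m' N.+ d N.* alpha K N.+ alpha K        ≡⟨ solve 3 (λ s x α → s :+ x :+ α := s :+ (α :+ x)) refl (Σα m') (d N.* alpha K) (alpha K) ⟩
  Σα m' N.+ suc d N.* alpha K                ∎
  where
  open ℕ-Solver.+-*-Solver
  open ℕ.≤-Reasoning
  m≤m'+d : m N.≤ m' N.+ d
  m≤m'+d = ℕ.≤-pred (subst (suc m N.≤_) (ℕ.+-suc m' d) m<m'+d)

-- ψ = k·Σα k − Φ; working with ψ avoids subtraction.
ψ : ∀ {k n} → Config k n → Config k n → ℕ
ψ {k} q a = k N.* Σα (agree q a)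

ψ≤kΣαk : ∀ {k n} (q a : Config k n) → ψ q a N.≤ k N.* Σα k
ψ≤kΣαk {k} q a = ℕ.*-monoʳ-≤ k (Σα-mono (agree≤k q a))

ψ-adversary : ∀ {k n} (q a a' : Config k n) → ψ q a N.≤ ψ q a' N.+ k N.* alpha k N.* hamming a a'
ψ-adversary {k} q a a' = begin
  k N.* Σα (agree q a)                        ≤⟨ ℕ.*-monoʳ-≤ k (Σα-lipschitz d (agree≤agree+hamming q a a') (agree≤k q a)) ⟩
  k N.* (Σα (agree q a') N.+ d N.* alpha k)   ≡⟨ solve 4 (λ k s d α → k :* (s :+ d :* α) := k :* s :+ k :* α :* d) refl k (Σα (agree q a')) d (alpha k) ⟩
  ψ q a' N.+ k N.* alpha k N.* d              ∎
  where
  open ℕ-Solver.+-*-Solver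
  open ℕ.≤-Reasoning
  d = hamming a a'

Σα-exchange : ∀ {x m} b c → b N.+ c N.≤ 1 → x N.+ b ≡ m N.+ c →
              Σα x N.+ b N.* alpha m ≡ Σα m N.+ c N.* alpha (suc m)
Σα-exchange {x} {m} 0 0 _ x≡m
  rewrite ℕ.+-identityʳ x | ℕ.+-identityʳ m | x≡m = refl
Σα-exchange {x} {m} 1 0 _ x+1≡m
  rewrite ℕ.+-identityʳ m | sym x+1≡m | ℕ.+-comm x 1 = sym (ℕ.+-assoc (Σα x) (alpha (suc x)) 0)
Σα-exchange {x} {m} 0 1 _ x≡m+1
  rewrite ℕ.+-identityʳ x | x≡m+1 | ℕ.+-comm m 1 = ℕ.+-assoc (Σα m) (alpha (suc m)) 0
Σα-exchange 1             (suc _)       (s≤s ())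
Σα-exchange 0             (suc (suc _)) (s≤s ())
Σα-exchange (suc (suc _)) _             (s≤s ())

Σα-update : ∀ {k n} (q a r : Config k n) i → q i ≢ r i →
            Σα (agree (update q i (r i)) a) N.+ same (q i) (a i) N.* alpha (agree q a)
              ≡ Σα (agree q a) N.+ same (r i) (a i) N.* alpha (suc (agree q a))
Σα-update q a r i qi≢ri =
  Σα-exchange (same (q i) (a i)) (same (r i) (a i)) (same+same≤1 (a i) qi≢ri) (agree-update q a i (r i))

ψ-algorithm : ∀ {k n} (q a r : Config k n) → (∀ i → q i ≢ r i) → Serves a r →
              suc (ψ q a) N.≤ ∑[ i < k ] Σα (agree (update q i (r i)) a)
-- The first step is the recursion α (m + 1) = 1 + m · α m, up to reassociation.
ψ-algorithm {k} q a r unserved serves = ℕ.+-cancelʳ-≤ (m N.* alpha m) _ _ (begin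
  suc (k N.* Σα m) N.+ m N.* alpha m                          ≡⟨ ℕ.+-suc (k N.* Σα m) (m N.* alpha m) ⟨
  k N.* Σα m N.+ alpha (suc m)                                 ≡⟨ cong (k N.* Σα m N.+_) (ℕ.*-identityˡ (alpha (suc m))) ⟨
  k N.* Σα m N.+ 1 N.* alpha (suc m)                           ≤⟨ ℕ.+-monoʳ-≤ (k N.* Σα m) (ℕ.*-monoˡ-≤ (alpha (suc m)) (serves⇒agree>0 serves)) ⟩
  k N.* Σα m N.+ agree r a N.* alpha (suc m)                   ≡⟨ cong₂ N._+_ (sym (∑-const {k} (Σα m))) (*-distribʳ-sum (alpha (suc m)) (λ i → same (r i) (a i))) ⟩
  ∑[ i < k ] Σα m N.+ ∑[ i < k ] (same (r i) (a i) N.* alpha (suc m))  ≡⟨ ∑-distrib-+ (λ _ → Σα m) (λ i → same (r i) (a i) N.* alpha (suc m)) ⟨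
  ∑[ i < k ] (Σα m N.+ same (r i) (a i) N.* alpha (suc m))      ≡⟨ sum-cong-≗ (λ i → Σα-update q a r i (unserved i)) ⟨
  ∑[ i < k ] (Σα (mᵢ i) N.+ same (q i) (a i) N.* alpha m)      ≡⟨ ∑-distrib-+ (Σα ∘ mᵢ) (λ i → same (q i) (a i) N.* alpha m) ⟩
  ∑[ i < k ] Σα (mᵢ i) N.+ ∑[ i < k ] (same (q i) (a i) N.* alpha m)  ≡⟨ cong (∑[ i < k ] Σα (mᵢ i) N.+_) (*-distribʳ-sum (alpha m) (λ i → same (q i) (a i))) ⟨
  ∑[ i < k ] Σα (mᵢ i) N.+ m N.* alpha m                       ∎)
  where
  open ℕ.≤-Reasoning
  m = agree q a
  mᵢ : Fin k → ℕ
  mᵢ i = agree (update q i (r i)) a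

toℚ≡mkℚ : ∀ m → toℚ m ≡ mkℚ (ℤ.+ m) 0 (coprime-sym (1-coprimeTo m))
toℚ≡mkℚ m = normalize-coprime (coprime-sym (1-coprimeTo m))

-- Addition in ℚ normalises its result, so the identity is checked in ℚᵘ.
toℚ-suc : ∀ m → toℚ (suc m) ≡ 1ℚ + toℚ m
toℚ-suc m = toℚᵘ-injective (ℚᵘ.≃-trans (toℚᵘ-toℚ (suc m)) (ℚᵘ.≃-trans (ℚᵘ.*≡* numerators)
  (ℚᵘ.≃-sym (ℚᵘ.≃-trans (toℚᵘ-homo-+ 1ℚ (toℚ m)) (ℚᵘ.+-congʳ (mkℚᵘ (ℤ.+ 1) 0) (toℚᵘ-toℚ m))))))
  where
  toℚᵘ-toℚ : ∀ m → toℚᵘ (toℚ m) ℚᵘ.≃ mkℚᵘ (ℤ.+ m) 0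
  toℚᵘ-toℚ m rewrite toℚ≡mkℚ m = ℚᵘ.≃-refl
  numerators : (ℤ.+ suc m) ℤ.* ℤ.1ℤ ≡ (ℤ.1ℤ ℤ.* ℤ.1ℤ ℤ.+ (ℤ.+ m) ℤ.* ℤ.1ℤ) ℤ.* ℤ.1ℤ
  numerators = trans (ℤ.*-identityʳ _) (sym (trans (ℤ.*-identityʳ _) (cong (λ x → ℤ.1ℤ ℤ.+ x) (ℤ.*-identityʳ (ℤ.+ m)))))

toℚ-+ : ∀ a b → toℚ (a N.+ b) ≡ toℚ a + toℚ b
toℚ-+ zero    b = sym (+-identityˡ (toℚ b))
toℚ-+ (suc a) b = begin
  toℚ (suc (a N.+ b))     ≡⟨ toℚ-suc (a N.+ b) ⟩
  1ℚ + toℚ (a N.+ b)      ≡⟨ cong (1ℚ +_) (toℚ-+ a b) ⟩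
  1ℚ + (toℚ a + toℚ b)    ≡⟨ +-assoc 1ℚ (toℚ a) (toℚ b) ⟨
  1ℚ + toℚ a + toℚ b      ≡⟨ cong (_+ toℚ b) (toℚ-suc a) ⟨
  toℚ (suc a) + toℚ b     ∎
  where open ≡-Reasoning

toℚ-* : ∀ a b → toℚ (a N.* b) ≡ toℚ a * toℚ b
toℚ-* zero    b = sym (*-zeroˡ (toℚ b))
toℚ-* (suc a) b = begin
  toℚ (b N.+ a N.* b)          ≡⟨ toℚ-+ b (a N.* b) ⟩
  toℚ b + toℚ (a N.* b)        ≡⟨ cong (toℚ b +_) (toℚ-* a b) ⟩
  toℚ b + toℚ a * toℚ b        ≡⟨ cong (_+ toℚ a * toℚ b) (*-identityˡ (toℚ b)) ⟨
  1ℚ * toℚ b + toℚ a * toℚ b   ≡⟨ *-distribʳ-+ (toℚ b) 1ℚ (toℚ a) ⟨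
  (1ℚ + toℚ a) * toℚ b         ≡⟨ cong (_* toℚ b) (toℚ-suc a) ⟨
  toℚ (suc a) * toℚ b          ∎
  where open ≡-Reasoning

toℚ-mono-≤ : ∀ {a b} → a N.≤ b → toℚ a ≤ toℚ b
toℚ-mono-≤ {a} {b} a≤b rewrite toℚ≡mkℚ a | toℚ≡mkℚ b =
  *≤* (subst₂ ℤ._≤_ (sym (ℤ.*-identityʳ (ℤ.+ a))) (sym (ℤ.*-identityʳ (ℤ.+ b))) (ℤ.+≤+ a≤b))

toℚ-nonNeg : ∀ m → NonNegative (toℚ m)
toℚ-nonNeg m = normalize-nonNeg m 1

1/k*k≡1 : ∀ k .{{_ : NonZero k}} → (ℤ.+ 1 / k) * toℚ k ≡ 1ℚ
1/k*k≡1 (suc m) rewrite toℚ≡mkℚ (suc m) | normalize-coprime {1} {m} (1-coprimeTo (suc m)) =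
  *-inverseˡ (mkℚ (ℤ.+ suc m) 0 (coprime-sym (1-coprimeTo (suc m))))

sumFin-+ : ∀ {k} (f g : Fin k → ℚ) → sumFin (λ i → f i + g i) ≡ sumFin f + sumFin g
sumFin-+ {zero}  f g = sym (+-identityˡ 0ℚ)
sumFin-+ {suc k} f g = trans (cong (f zero + g zero +_) (sumFin-+ (f ∘ suc) (g ∘ suc)))
  (solve 4 (λ a b c d → (a :+ b) :+ (c :+ d) := (a :+ c) :+ (b :+ d)) refl (f zero) (g zero) _ _)
  where open ℚ-Solver.+-*-Solver

sumFin-mono-≤ : ∀ {k} {f g : Fin k → ℚ} → (∀ i → f i ≤ g i) → sumFin f ≤ sumFin g
sumFin-mono-≤ {zero}  h = ≤-refl
sumFin-mono-≤ {suc k} h = +-mono-≤ (h zero) (sumFin-mono-≤ (h ∘ suc))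

sumFin-*ˡ : ∀ {k} c (f : Fin k → ℚ) → sumFin (λ i → c * f i) ≡ c * sumFin f
sumFin-*ˡ {zero}  c f = sym (*-zeroʳ c)
sumFin-*ˡ {suc k} c f = trans (cong (c * f zero +_) (sumFin-*ˡ c (f ∘ suc))) (sym (*-distribˡ-+ c (f zero) _))

sumFin-const : ∀ {k} x → sumFin {k} (λ _ → x) ≡ toℚ k * x
sumFin-const {zero}  x = sym (*-zeroˡ x)
sumFin-const {suc k} x = begin
  x + sumFin {k} (λ _ → x)   ≡⟨ cong (x +_) (sumFin-const {k} x) ⟩
  x + toℚ k * x              ≡⟨ cong (_+ toℚ k * x) (*-identityˡ x) ⟨
  1ℚ * x + toℚ k * x         ≡⟨ *-distribʳ-+ x 1ℚ (toℚ k) ⟨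
  (1ℚ + toℚ k) * x           ≡⟨ cong (_* x) (toℚ-suc k) ⟨
  toℚ (suc k) * x            ∎
  where open ≡-Reasoning

sumFin-toℚ : ∀ {k} (f : Fin k → ℕ) → sumFin (toℚ ∘ f) ≡ toℚ (sum f)
sumFin-toℚ {zero}  f = refl
sumFin-toℚ {suc k} f = trans (cong (toℚ (f zero) +_) (sumFin-toℚ (f ∘ suc))) (sym (toℚ-+ (f zero) _))

module Amortised (k n : ℕ) .{{_ : NonZero k}} where
  open Harmonic k n

  C K : ℚ
  C = toℚ (k N.* alpha k)
  K = toℚ (k N.* Σα k)

  Ψ : Config k n → Config k n → ℚ
  Ψ q a = toℚ (ψ q a)

  private
    w : ℚ
    w = ℤ.+ 1 / k

    instance
      w-nonNeg : NonNegative w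
      w-nonNeg = normalize-nonNeg 1 k

  expect-+ : ∀ q r (f g : Config k n → ℚ) → expect q r f + expect q r g ≡ expect q r (λ x → f x + g x)
  expect-+ q r f g with any? (λ i → q i ≟ᶠ r i)
  ... | yes _ = refl
  ... | no  _ = trans (sym (*-distribˡ-+ w _ _)) (cong (w *_) (sym (sumFin-+ (λ i → f (update q i (r i))) (λ i → g (update q i (r i))))))

  expect-mono-≤ : ∀ q r {f g : Config k n → ℚ} → (∀ x → f x ≤ g x) → expect q r f ≤ expect q r g
  expect-mono-≤ q r f≤g with any? (λ i → q i ≟ᶠ r i)
  ... | yes _ = f≤g q
  ... | no  _ = *-monoˡ-≤-nonNeg w (sumFin-mono-≤ (λ i → f≤g (update q i (r i))))

  expect-affine : ∀ q r c d (f : Config k n → ℚ) → expect q r (λ x → c * f x + d) ≡ c * expect q r f + d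
  expect-affine q r c d f with any? (λ i → q i ≟ᶠ r i)
  ... | yes _ = refl
  ... | no  _ = begin
    w * sumFin (λ i → c * F i + d)          ≡⟨ cong (w *_) (sumFin-+ (λ i → c * F i) (λ _ → d)) ⟩
    w * (sumFin (λ i → c * F i) + sumFin {k} (λ _ → d))  ≡⟨ cong (w *_) (cong₂ _+_ (sumFin-*ˡ c F) (sumFin-const {k} d)) ⟩
    w * (c * sumFin F + toℚ k * d)          ≡⟨ solve 5 (λ w c s t d → w :* (c :* s :+ t :* d) := c :* (w :* s) :+ (w :* t) :* d) refl w c (sumFin F) (toℚ k) d ⟩
    c * (w * sumFin F) + (w * toℚ k) * d    ≡⟨ cong (λ x → c * (w * sumFin F) + x * d) (1/k*k≡1 k) ⟩
    c * (w * sumFin F) + 1ℚ * d             ≡⟨ cong (c * (w * sumFin F) +_) (*-identityˡ d) ⟩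
    c * (w * sumFin F) + d                  ∎
    where
    open ≡-Reasoning
    open ℚ-Solver.+-*-Solver
    F : Fin k → ℚ
    F i = f (update q i (r i))

  Ψ-adversary : ∀ q a a' → Ψ q a ≤ Ψ q a' + C * toℚ (hamming a a')
  Ψ-adversary q a a' = begin
    toℚ (ψ q a)                                                 ≤⟨ toℚ-mono-≤ (ψ-adversary q a a') ⟩
    toℚ (ψ q a' N.+ k N.* alpha k N.* hamming a a')             ≡⟨ toℚ-+ (ψ q a') _ ⟩
    toℚ (ψ q a') + toℚ (k N.* alpha k N.* hamming a a')         ≡⟨ cong (toℚ (ψ q a') +_) (toℚ-* (k N.* alpha k) (hamming a a')) ⟩
    Ψ q a' + C * toℚ (hamming a a')                             ∎
    where open ≤-Reasoning

  Ψ-algorithm : ∀ q r a' → Serves a' r → stepCost q r + Ψ q a' ≤ expect q r (λ q' → Ψ q' a')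
  Ψ-algorithm q r a' serves with any? (λ i → q i ≟ᶠ r i)
  ... | yes _        = ≤-reflexive (+-identityˡ _)
  ... | no  unserved = begin
    1ℚ + toℚ (ψ q a')                                ≡⟨ toℚ-suc (ψ q a') ⟨
    toℚ (suc (ψ q a'))                               ≤⟨ toℚ-mono-≤ (ψ-algorithm q a' r (λ i qi≡ri → unserved (i , qi≡ri)) serves) ⟩
    toℚ S                                            ≡⟨ *-identityˡ (toℚ S) ⟨
    1ℚ * toℚ S                                       ≡⟨ cong (_* toℚ S) (1/k*k≡1 k) ⟨
    w * toℚ k * toℚ S                                ≡⟨ *-assoc w (toℚ k) (toℚ S) ⟩
    w * (toℚ k * toℚ S)                              ≡⟨ cong (w *_) (toℚ-* k S) ⟨
    w * toℚ (k N.* S)                                ≡⟨ cong (λ x → w * toℚ x) (*-distribˡ-sum k (Σα ∘ mᵢ)) ⟩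
    w * toℚ (∑[ i < k ] ψ (update q i (r i)) a')     ≡⟨ cong (w *_) (sumFin-toℚ (λ i → ψ (update q i (r i)) a')) ⟨
    w * sumFin (λ i → Ψ (update q i (r i)) a')       ∎
    where
    open ≤-Reasoning
    mᵢ : Fin k → ℕ
    mᵢ i = agree (update q i (r i)) a'
    S = ∑[ i < k ] Σα (mᵢ i)

  amortised : ∀ T (A : Adv k n T) q a → algCost T A q a + Ψ q a ≤ C * advCost T A q a + K
  amortised zero _ q a = begin
    0ℚ + Ψ q a     ≡⟨ +-identityˡ (Ψ q a) ⟩
    Ψ q a          ≤⟨ toℚ-mono-≤ (ψ≤kΣαk q a) ⟩
    K              ≡⟨ +-identityˡ K ⟨
    0ℚ + K         ≡⟨ cong (_+ K) (*-zeroʳ C) ⟨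
    C * 0ℚ + K     ∎
    where open ≤-Reasoning
  amortised (suc T) (r , a' , serves , next) q a = begin
    s + EF + Ψ q a                            ≤⟨ +-monoʳ-≤ (s + EF) (Ψ-adversary q a a') ⟩
    s + EF + (Ψ q a' + C * d)                 ≡⟨ solve 4 (λ s f p c → s :+ f :+ (p :+ c) := s :+ p :+ f :+ c) refl s EF (Ψ q a') (C * d) ⟩
    s + Ψ q a' + EF + C * d                   ≤⟨ +-monoˡ-≤ (C * d) (+-monoˡ-≤ EF (Ψ-algorithm q r a' serves)) ⟩
    EH + EF + C * d                           ≡⟨ cong (_+ C * d) (trans (+-comm EH EF) (expect-+ q r F H)) ⟩
    expect q r (λ x → F x + H x) + C * d      ≤⟨ +-monoˡ-≤ (C * d) (expect-mono-≤ q r (λ q' → amortised T (next q') q' a')) ⟩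
    expect q r (λ x → C * G x + K) + C * d    ≡⟨ cong (_+ C * d) (expect-affine q r C K G) ⟩
    C * EG + K + C * d                        ≡⟨ solve 4 (λ c g x d → c :* g :+ x :+ c :* d := c :* (d :+ g) :+ x) refl C EG K d ⟩
    C * (d + EG) + K                          ∎
    where
    open ≤-Reasoning
    open ℚ-Solver.+-*-Solver
    F G H : Config k n → ℚ
    F q' = algCost T (next q') q' a'
    G q' = advCost T (next q') q' a'
    H q' = Ψ q' a'
    s  = stepCost q r
    d  = toℚ (hamming a a')
    EF = expect q r F
    EG = expect q r G
    EH = expect q r H

  competitive : ∀ q₀ T (A : Adv k n T) → algCost T A q₀ q₀ ≤ C * advCost T A q₀ q₀ + K
  competitive q₀ T A = ≤-trans cost≤cost+Ψ (amortised T A q₀ q₀)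
    where
    cost = algCost T A q₀ q₀
    cost≤cost+Ψ : cost ≤ cost + Ψ q₀ q₀
    cost≤cost+Ψ = subst (_≤ cost + Ψ q₀ q₀) (+-identityʳ cost)
                    (+-monoʳ-≤ cost (nonNegative⁻¹ (Ψ q₀ q₀) {{toℚ-nonNeg (ψ q₀ q₀)}}))

theorem1 : (k n : ℕ) .{{_ : NonZero k}} → ∃ λ (c : ℚ) →
    (q₀ : Config k n) (T : ℕ) (A : Adv k n T) →
      Harmonic.algCost k n T A q₀ q₀ ≤ toℚ (k N.* alpha k) * Harmonic.advCost k n T A q₀ q₀ + c
theorem1 k n = Amortised.K k n , Amortised.competitive k n
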